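{- Let $M,N$ be terms of the extended stack calculus. If $M$ and $N$ are separable, then $M\not\simeq N$.
   Context: The extended stack calculus. Stack variables $\alpha,\beta,\gamma,\ldots$. Stacks $\pi ::= \mathsf{nil}\mid\alpha\mid\mathsf{cdr}(\pi)\mid M::\pi$; terms $M ::= \mathsf{car}(\pi)\mid\mu\alpha.M\mid M\star\pi$ ($\star$ left-associative with precedence over $\mu$; $::$ right-associative, binding tighter than $\star$; $\mu\vec\alpha.M\star\vec\pi$ abbreviates $\mu\alpha_1\ldots\mu\alpha_n.(M\star\pi_1\star\cdots\star\pi_m)$). $E\{\pi/\alpha\}$ is capture-avoiding substitution. Reduction rules: $(\mu\alpha.M)\star\pi\to M\{\pi/\alpha\}$, $\mathsf{car}(M::\pi)\to M$, $\mathsf{cdr}(M::\pi)\to\pi$; $=_s$ is the equivalence closure of their contextual closure. $\mathsf{cdr}^n$ is $n$-fold $\mathsf{cdr}$, $\mathsf{car}_n(\pi):=\mathsf{car}(\mathsf{cdr}^n(\pi))$. Canonical form: normal form w.r.t. the $\mathsf{car},\mathsf{cdr}$ rules. Head reduction: $M\to_h\mu\vec\alpha.N\{\varpi/\beta\}\star\vec\pi$ if $\mu\vec\alpha.(\mu\beta.N)\star\varpi\star\vec\pi$ is the canonical form of $M$ (no contextual closure). Hnf: non-$\to_h$-reducible term $\mu\vec\alpha.H\star\vec\pi$, proper if $H=\mathsf{car}_n(\beta)$, improper if $H=\mathsf{car}_n(\mathsf{nil})$. Head contexts: $C[\cdot]::=[\cdot]\mid C[\cdot]\star\pi\mid\mu\alpha.C[\cdot]$.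 $M\simeq N$ iff for every head context $C$, $C[M]$ $\to_h$-reduces to a proper hnf iff $C[N]$ does. Let $\mathbf T:=\mu\alpha.\mathsf{car}_0(\alpha)\star\mathsf{cdr}^2(\alpha)$ and $\mathbf F:=\mu\alpha.\mathsf{car}_1(\alpha)\star\mathsf{cdr}^2(\alpha)$. $M$ and $N$ are separable if there is a head context $C[\cdot]$ with $C[M]=_s\mathbf T$ and $C[N]=_s\mathbf F$. -}

module Defs where

open import Data.Nat using (ℕ; zero; suc; _≡ᵇ_)
open import Data.Bool using (Bool; true; false; if_then_else_)
open import Data.List using (List; []; _∷_)
open import Data.Product using (Σ; ∃; _×_; _,_)
open import Relation.Nullary using (¬_)
open import Relation.Binary.PropositionalEquality using (_≡_)
open import Relation.Binary.Construct.Closure.ReflexiveTransitive using (Star)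
open import Relation.Binary.Construct.Closure.Equivalence using (EqClosure)

-- Syntax of the extended stack calculus (stack variables as de Bruijn
-- indices; μ binds index 0).

infixr 6 _::_
infixl 5 _⋆_

mutual
  data Stack : Set where
    nil  : Stack
    var  : ℕ → Stack
    cdr  : Stack → Stack
    _::_ : Term → Stack → Stack

  data Term : Set where
    car : Stack → Term
    μ   : Term → Term
    _⋆_ : Term → Stack → Term

cdr^ : ℕ → Stack → Stack
cdr^ zero    π = π
cdr^ (suc n) π = cdr (cdr^ n π)

carₙ : ℕ → Stack → Term
carₙ n π = car (cdr^ n π)

mus : ℕ → Term → Term
mus zero    M = M
mus (suc k) M = μ (mus k M)

apps : Term → List Stack → Term
apps M []       = M
apps M (π ∷ πs) = apps (M ⋆ π) πs

lift : (ℕ → ℕ) → ℕ → ℕ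
lift ρ zero    = zero
lift ρ (suc x) = suc (ρ x)

mutual
  renS : (ℕ → ℕ) → Stack → Stack
  renS ρ nil      = nil
  renS ρ (var x)  = var (ρ x)
  renS ρ (cdr π)  = cdr (renS ρ π)
  renS ρ (M :: π) = renT ρ M :: renS ρ π

  renT : (ℕ → ℕ) → Term → Term
  renT ρ (car π) = car (renS ρ π)
  renT ρ (μ M)   = μ (renT (lift ρ) M)
  renT ρ (M ⋆ π) = renT ρ M ⋆ renS ρ π

exts : (ℕ → Stack) → ℕ → Stack
exts σ zero    = var zero
exts σ (suc x) = renS suc (σ x)

mutual
  subS : (ℕ → Stack) → Stack → Stack
  subS σ nil      = nil
  subS σ (var x)  = σ x
  subS σ (cdr π)  = cdr (subS σ π)
  subS σ (M :: π) = subT σ M :: subS σ π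

  subT : (ℕ → Stack) → Term → Term
  subT σ (car π) = car (subS σ π)
  subT σ (μ M)   = μ (subT (exts σ) M)
  subT σ (M ⋆ π) = subT σ M ⋆ subS σ π

single : Stack → ℕ → Stack
single π zero    = π
single π (suc x) = var x

-- M [ π ]  is  M{π/α}  where α is the variable bound by the enclosing μ
_[_] : Term → Stack → Term
M [ π ] = subT (single π) M

-- One-step reduction, contextually closed.  The index b says whether
-- the μ-rule is allowed (true: all three rules; false: only car/cdr).

mutual
  data StepT : Bool → Term → Term → Set where
    μ-red   : ∀ {M π} → StepT true (μ M ⋆ π) (M [ π ])
    car-red : ∀ {b M π} → StepT b (car (M :: π)) M
    car-c   : ∀ {b π π'} → StepS b π π' → StepT b (car π) (car π')
    μ-c     : ∀ {b M M'} → StepT b M M' → StepT b (μ M) (μ M')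
    ⋆-l     : ∀ {b M M' π} → StepT b M M' → StepT b (M ⋆ π) (M' ⋆ π)
    ⋆-r     : ∀ {b M π π'} → StepS b π π' → StepT b (M ⋆ π) (M ⋆ π')

  data StepS : Bool → Stack → Stack → Set where
    cdr-red : ∀ {b M π} → StepS b (cdr (M :: π)) π
    cdr-c   : ∀ {b π π'} → StepS b π π' → StepS b (cdr π) (cdr π')
    ::-l    : ∀ {b M M' π} → StepT b M M' → StepS b (M :: π) (M' :: π)
    ::-r    : ∀ {b M π π'} → StepS b π π' → StepS b (M :: π) (M :: π')

infix 4 _=s_
_=s_ : Term → Term → Set
_=s_ = EqClosure (StepT true)

CCNormal : Term → Set
CCNormal N = ∀ N' → ¬ StepT false N N'

CanonicalForm : Term → Term → Set
CanonicalForm M N = Star (StepT false) M N × CCNormal N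

data _→h_ (M : Term) : Term → Set where
  head : ∀ k N ϖ πs →
         CanonicalForm M (mus k (apps (μ N) (ϖ ∷ πs))) →
         M →h mus k (apps (N [ ϖ ]) πs)

HeadIrreducible : Term → Set
HeadIrreducible M = ∀ M' → ¬ (M →h M')

ProperHnf : Term → Set
ProperHnf M = HeadIrreducible M ×
  (Σ ℕ λ k → Σ ℕ λ n → Σ ℕ λ β → Σ (List Stack) λ πs →
     CanonicalForm M (mus k (apps (carₙ n (var β)) πs)))

HeadReducesToProper : Term → Set
HeadReducesToProper M = ∃ λ M' → Star _→h_ M M' × ProperHnf M'

-- Variables are named by natural numbers; a free
-- variable named i of a top-level term is de Bruijn index i.  The
-- binder  μ[ j ] C  binds the variable NAMED j, so plugging a term into
-- the hole may capture any of its free variables (as in the named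
-- calculus, where contexts are not capture-avoiding).  Stacks occurring
-- in a context are written in de Bruijn form relative to their position.

data HCtx : Set where
  hole  : HCtx
  _⋆C_  : HCtx → Stack → HCtx
  μ[_]_ : ℕ → HCtx → HCtx

bindAt : ℕ → (ℕ → ℕ) → ℕ → ℕ
bindAt j ρ x = if x ≡ᵇ j then zero else suc (ρ x)

plugWith : HCtx → (ℕ → ℕ) → Term → Term
plugWith hole      ρ M = renT ρ M
plugWith (C ⋆C π)  ρ M = plugWith C ρ M ⋆ π
plugWith (μ[ j ] C) ρ M = μ (plugWith C (bindAt j ρ) M)

infix 30 _⟦_⟧
_⟦_⟧ : HCtx → Term → Term
C ⟦ M ⟧ = plugWith C (λ x → x) M

infix 4 _≃_
_≃_ : Term → Term → Set
M ≃ N = ∀ (C : HCtx) →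
  (HeadReducesToProper (C ⟦ M ⟧) → HeadReducesToProper (C ⟦ N ⟧)) ×
  (HeadReducesToProper (C ⟦ N ⟧) → HeadReducesToProper (C ⟦ M ⟧))

𝐓 : Term
𝐓 = μ (carₙ 0 (var 0) ⋆ cdr^ 2 (var 0))

𝐅 : Term
𝐅 = μ (carₙ 1 (var 0) ⋆ cdr^ 2 (var 0))

Separable : Term → Term → Set
Separable M N = Σ HCtx λ C → (C ⟦ M ⟧ =s 𝐓) × (C ⟦ N ⟧ =s 𝐅)

-- If a head context C sends M to T and N to F, then the context C ⋆ π₀
-- with π₀ = car(α) :: car(nil) :: nil sends M to a term convertible with
-- the proper normal form car(α) ⋆ nil and N to a term convertible with
-- the improper normal form car(nil) ⋆ nil.  It then suffices to show
--   (a) a term convertible with a variable-headed normal form head-reduces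
--       to a proper hnf, and
--   (b) a term convertible with an irreducible term that is not
--       variable-headed (even under μ's) never head-reduces to a proper hnf.
-- Both rest on the Church–Rosser theorem, proved by parallel reduction and
-- complete developments (after the usual substitution algebra).  For (a)
-- we add a standardisation theorem: a reduction to a variable-headed term
-- can be replaced by weak head steps; these are then turned into head
-- steps of the calculus, which work on canonical (car/cdr-normal) forms,
-- using the normalisation function nfT.  For (b) we use that being
-- variable-headed under μ's is preserved by reduction.
module Submission where

open import Defs
open import Relation.Nullary using (¬_)
open import Data.Nat using (ℕ; zero; suc)
open import Data.Bool using (Bool; true; false)
open import Data.Empty using (⊥-elim)
open import Data.Sum using (_⊎_; inj₁; inj₂)
open import Data.List using ([]; _∷_; _++_; map)
open import Data.Product using (∃; _×_; _,_; proj₁)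
open import Relation.Binary.PropositionalEquality using (_≡_; refl; sym; trans; cong; cong₂; subst)
open import Relation.Binary.Construct.Closure.ReflexiveTransitive using (Star; ε; _◅_; _◅◅_)
import Relation.Binary.Construct.Closure.ReflexiveTransitive as Star
import Relation.Binary.Construct.Closure.Equivalence as EQ
open import Relation.Binary.Construct.Closure.Symmetric using (fwd; bwd)

-- They are stated for
-- maps related pointwise, which avoids function extensionality; under a
-- binder the pointwise hypothesis is transported along lift/exts.

mutual
  ren-renS : ∀ ρ ρ' ρ'' → (∀ x → ρ (ρ' x) ≡ ρ'' x) → ∀ π → renS ρ (renS ρ' π) ≡ renS ρ'' π
  ren-renS ρ ρ' ρ'' h nil      = refl
  ren-renS ρ ρ' ρ'' h (var x)  = cong var (h x)
  ren-renS ρ ρ' ρ'' h (cdr π)  = cong cdr (ren-renS ρ ρ' ρ'' h π)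
  ren-renS ρ ρ' ρ'' h (M :: π) = cong₂ _::_ (ren-renT ρ ρ' ρ'' h M) (ren-renS ρ ρ' ρ'' h π)

  ren-renT : ∀ ρ ρ' ρ'' → (∀ x → ρ (ρ' x) ≡ ρ'' x) → ∀ M → renT ρ (renT ρ' M) ≡ renT ρ'' M
  ren-renT ρ ρ' ρ'' h (car π) = cong car (ren-renS ρ ρ' ρ'' h π)
  ren-renT ρ ρ' ρ'' h (μ M)   = cong μ (ren-renT (lift ρ) (lift ρ') (lift ρ'') h↑ M)
    where h↑ : ∀ x → lift ρ (lift ρ' x) ≡ lift ρ'' x
          h↑ zero    = refl
          h↑ (suc x) = cong suc (h x)
  ren-renT ρ ρ' ρ'' h (M ⋆ π) = cong₂ _⋆_ (ren-renT ρ ρ' ρ'' h M) (ren-renS ρ ρ' ρ'' h π)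

mutual
  sub-renS : ∀ σ ρ σ' → (∀ x → σ (ρ x) ≡ σ' x) → ∀ π → subS σ (renS ρ π) ≡ subS σ' π
  sub-renS σ ρ σ' h nil      = refl
  sub-renS σ ρ σ' h (var x)  = h x
  sub-renS σ ρ σ' h (cdr π)  = cong cdr (sub-renS σ ρ σ' h π)
  sub-renS σ ρ σ' h (M :: π) = cong₂ _::_ (sub-renT σ ρ σ' h M) (sub-renS σ ρ σ' h π)

  sub-renT : ∀ σ ρ σ' → (∀ x → σ (ρ x) ≡ σ' x) → ∀ M → subT σ (renT ρ M) ≡ subT σ' M
  sub-renT σ ρ σ' h (car π) = cong car (sub-renS σ ρ σ' h π)
  sub-renT σ ρ σ' h (μ M)   = cong μ (sub-renT (exts σ) (lift ρ) (exts σ') h↑ M)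
    where h↑ : ∀ x → exts σ (lift ρ x) ≡ exts σ' x
          h↑ zero    = refl
          h↑ (suc x) = cong (renS suc) (h x)
  sub-renT σ ρ σ' h (M ⋆ π) = cong₂ _⋆_ (sub-renT σ ρ σ' h M) (sub-renS σ ρ σ' h π)

ren-weaken : ∀ ρ π → renS (lift ρ) (renS suc π) ≡ renS suc (renS ρ π)
ren-weaken ρ π = trans (ren-renS (lift ρ) suc (λ y → suc (ρ y)) (λ _ → refl) π)
                       (sym (ren-renS suc ρ (λ y → suc (ρ y)) (λ _ → refl) π))

mutual
  ren-subS : ∀ ρ σ σ' → (∀ x → renS ρ (σ x) ≡ σ' x) → ∀ π → renS ρ (subS σ π) ≡ subS σ' π
  ren-subS ρ σ σ' h nil      = refl
  ren-subS ρ σ σ' h (var x)  = h x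
  ren-subS ρ σ σ' h (cdr π)  = cong cdr (ren-subS ρ σ σ' h π)
  ren-subS ρ σ σ' h (M :: π) = cong₂ _::_ (ren-subT ρ σ σ' h M) (ren-subS ρ σ σ' h π)

  ren-subT : ∀ ρ σ σ' → (∀ x → renS ρ (σ x) ≡ σ' x) → ∀ M → renT ρ (subT σ M) ≡ subT σ' M
  ren-subT ρ σ σ' h (car π) = cong car (ren-subS ρ σ σ' h π)
  ren-subT ρ σ σ' h (μ M)   = cong μ (ren-subT (lift ρ) (exts σ) (exts σ') h↑ M)
    where h↑ : ∀ x → renS (lift ρ) (exts σ x) ≡ exts σ' x
          h↑ zero    = refl
          h↑ (suc x) = trans (ren-weaken ρ (σ x)) (cong (renS suc) (h x))
  ren-subT ρ σ σ' h (M ⋆ π) = cong₂ _⋆_ (ren-subT ρ σ σ' h M) (ren-subS ρ σ σ' h π)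

mutual
  sub-subS : ∀ σ τ υ → (∀ x → subS σ (τ x) ≡ υ x) → ∀ π → subS σ (subS τ π) ≡ subS υ π
  sub-subS σ τ υ h nil      = refl
  sub-subS σ τ υ h (var x)  = h x
  sub-subS σ τ υ h (cdr π)  = cong cdr (sub-subS σ τ υ h π)
  sub-subS σ τ υ h (M :: π) = cong₂ _::_ (sub-subT σ τ υ h M) (sub-subS σ τ υ h π)

  sub-subT : ∀ σ τ υ → (∀ x → subS σ (τ x) ≡ υ x) → ∀ M → subT σ (subT τ M) ≡ subT υ M
  sub-subT σ τ υ h (car π) = cong car (sub-subS σ τ υ h π)
  sub-subT σ τ υ h (μ M)   = cong μ (sub-subT (exts σ) (exts τ) (exts υ) h↑ M)
    where h↑ : ∀ x → subS (exts σ) (exts τ x) ≡ exts υ x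
          h↑ zero    = refl
          h↑ (suc x) = trans (sub-renS (exts σ) suc (λ y → renS suc (σ y)) (λ _ → refl) (τ x))
                       (trans (sym (ren-subS suc σ (λ y → renS suc (σ y)) (λ _ → refl) (τ x)))
                              (cong (renS suc) (h x)))
  sub-subT σ τ υ h (M ⋆ π) = cong₂ _⋆_ (sub-subT σ τ υ h M) (sub-subS σ τ υ h π)

mutual
  sub-idS : ∀ σ → (∀ x → σ x ≡ var x) → ∀ π → subS σ π ≡ π
  sub-idS σ h nil      = refl
  sub-idS σ h (var x)  = h x
  sub-idS σ h (cdr π)  = cong cdr (sub-idS σ h π)
  sub-idS σ h (M :: π) = cong₂ _::_ (sub-idT σ h M) (sub-idS σ h π)

  sub-idT : ∀ σ → (∀ x → σ x ≡ var x) → ∀ M → subT σ M ≡ M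
  sub-idT σ h (car π) = cong car (sub-idS σ h π)
  sub-idT σ h (μ M)   = cong μ (sub-idT (exts σ) h↑ M)
    where h↑ : ∀ x → exts σ x ≡ var x
          h↑ zero    = refl
          h↑ (suc x) = cong (renS suc) (h x)
  sub-idT σ h (M ⋆ π) = cong₂ _⋆_ (sub-idT σ h M) (sub-idS σ h π)

sub-β : ∀ σ N ϖ → subT σ (N [ ϖ ]) ≡ subT (exts σ) N [ subS σ ϖ ]
sub-β σ N ϖ = trans (sub-subT σ (single ϖ) (λ x → subS σ (single ϖ x)) (λ _ → refl) N)
                    (sym (sub-subT (single (subS σ ϖ)) (exts σ) (λ x → subS σ (single ϖ x)) h N))
  where h : ∀ x → subS (single (subS σ ϖ)) (exts σ x) ≡ subS σ (single ϖ x)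
        h zero    = refl
        h (suc x) = trans (sub-renS (single (subS σ ϖ)) suc var (λ _ → refl) (σ x))
                          (sub-idS var (λ _ → refl) (σ x))

ren-β : ∀ ρ N ϖ → renT ρ (N [ ϖ ]) ≡ renT (lift ρ) N [ renS ρ ϖ ]
ren-β ρ N ϖ = trans (ren-subT ρ (single ϖ) (λ x → renS ρ (single ϖ x)) (λ _ → refl) N)
                    (sym (sub-renT (single (renS ρ ϖ)) (lift ρ) (λ x → renS ρ (single ϖ x)) h N))
  where h : ∀ x → single (renS ρ ϖ) (lift ρ x) ≡ renS ρ (single ϖ x)
        h zero    = refl
        h (suc x) = refl

Steps : Bool → Term → Term → Set
Steps b = Star (StepT b)

StepsS : Bool → Stack → Stack → Set
StepsS b = Star (StepS b)

mutual
  data ParT : Bool → Term → Term → Set where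
    pcar     : ∀ {b ρ ρ'} → ParS b ρ ρ' → ParT b (car ρ) (car ρ')
    pcar-red : ∀ {b M M' π} → ParT b M M' → ParT b (car (M :: π)) M'
    pμ       : ∀ {b M M'} → ParT b M M' → ParT b (μ M) (μ M')
    p⋆       : ∀ {b M M' π π'} → ParT b M M' → ParS b π π' → ParT b (M ⋆ π) (M' ⋆ π')
    pβ       : ∀ {M M' π π'} → ParT true M M' → ParS true π π' → ParT true (μ M ⋆ π) (M' [ π' ])

  data ParS : Bool → Stack → Stack → Set where
    pnil     : ∀ {b} → ParS b nil nil
    pvar     : ∀ {b} x → ParS b (var x) (var x)
    pcdr     : ∀ {b ρ ρ'} → ParS b ρ ρ' → ParS b (cdr ρ) (cdr ρ')
    pcdr-red : ∀ {b M π π'} → ParS b π π' → ParS b (cdr (M :: π)) π'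
    pcons    : ∀ {b M M' π π'} → ParT b M M' → ParS b π π' → ParS b (M :: π) (M' :: π')

mutual
  par-reflT : ∀ {b} M → ParT b M M
  par-reflT (car π) = pcar (par-reflS π)
  par-reflT (μ M)   = pμ (par-reflT M)
  par-reflT (M ⋆ π) = p⋆ (par-reflT M) (par-reflS π)

  par-reflS : ∀ {b} π → ParS b π π
  par-reflS nil      = pnil
  par-reflS (var x)  = pvar x
  par-reflS (cdr π)  = pcdr (par-reflS π)
  par-reflS (M :: π) = pcons (par-reflT M) (par-reflS π)

mutual
  par-renT : ∀ {b M M'} ρ → ParT b M M' → ParT b (renT ρ M) (renT ρ M')
  par-renT ρ (pcar d)     = pcar (par-renS ρ d)
  par-renT ρ (pcar-red d) = pcar-red (par-renT ρ d)
  par-renT ρ (pμ d)       = pμ (par-renT (lift ρ) d)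
  par-renT ρ (p⋆ d e)     = p⋆ (par-renT ρ d) (par-renS ρ e)
  par-renT ρ (pβ {M' = M'} {π' = π'} d e) =
    subst (ParT true _) (sym (ren-β ρ M' π')) (pβ (par-renT (lift ρ) d) (par-renS ρ e))

  par-renS : ∀ {b π π'} ρ → ParS b π π' → ParS b (renS ρ π) (renS ρ π')
  par-renS ρ pnil         = pnil
  par-renS ρ (pvar x)     = pvar (ρ x)
  par-renS ρ (pcdr d)     = pcdr (par-renS ρ d)
  par-renS ρ (pcdr-red d) = pcdr-red (par-renS ρ d)
  par-renS ρ (pcons d e)  = pcons (par-renT ρ d) (par-renS ρ e)

ParSub : Bool → (ℕ → Stack) → (ℕ → Stack) → Set
ParSub b σ σ' = ∀ x → ParS b (σ x) (σ' x)

par-exts : ∀ {b σ σ'} → ParSub b σ σ' → ParSub b (exts σ) (exts σ')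
par-exts h zero    = pvar zero
par-exts h (suc x) = par-renS suc (h x)

par-single : ∀ {b π π'} → ParS b π π' → ParSub b (single π) (single π')
par-single e zero    = e
par-single e (suc x) = pvar x

mutual
  par-subT : ∀ {b M M' σ σ'} → ParSub b σ σ' → ParT b M M' → ParT b (subT σ M) (subT σ' M')
  par-subT h (pcar d)     = pcar (par-subS h d)
  par-subT h (pcar-red d) = pcar-red (par-subT h d)
  par-subT h (pμ d)       = pμ (par-subT (par-exts h) d)
  par-subT h (p⋆ d e)     = p⋆ (par-subT h d) (par-subS h e)
  par-subT {σ' = σ'} h (pβ {M' = M'} {π' = π'} d e) =
    subst (ParT true _) (sym (sub-β σ' M' π')) (pβ (par-subT (par-exts h) d) (par-subS h e))

  par-subS : ∀ {b π π' σ σ'} → ParSub b σ σ' → ParS b π π' → ParS b (subS σ π) (subS σ' π')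
  par-subS h pnil         = pnil
  par-subS h (pvar x)     = h x
  par-subS h (pcdr d)     = pcdr (par-subS h d)
  par-subS h (pcdr-red d) = pcdr-red (par-subS h d)
  par-subS h (pcons d e)  = pcons (par-subT h d) (par-subS h e)

par-β : ∀ {b N N' π π'} → ParT b N N' → ParS b π π' → ParT b (N [ π ]) (N' [ π' ])
par-β d e = par-subT (par-single e) d

mutual
  step⇒parT : ∀ {b M M'} → StepT b M M' → ParT b M M'
  step⇒parT (μ-red {M} {π})      = pβ (par-reflT M) (par-reflS π)
  step⇒parT (car-red {M = M})    = pcar-red (par-reflT M)
  step⇒parT (car-c s)            = pcar (step⇒parS s)
  step⇒parT (μ-c s)              = pμ (step⇒parT s)
  step⇒parT (⋆-l {π = π} s)      = p⋆ (step⇒parT s) (par-reflS π)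
  step⇒parT (⋆-r {M = M} s)      = p⋆ (par-reflT M) (step⇒parS s)

  step⇒parS : ∀ {b π π'} → StepS b π π' → ParS b π π'
  step⇒parS (cdr-red {π = π})    = pcdr-red (par-reflS π)
  step⇒parS (cdr-c s)            = pcdr (step⇒parS s)
  step⇒parS (::-l {π = π} s)     = pcons (step⇒parT s) (par-reflS π)
  step⇒parS (::-r {M = M} s)     = pcons (par-reflT M) (step⇒parS s)

mutual
  par⇒stepsT : ∀ {b M M'} → ParT b M M' → Steps b M M'
  par⇒stepsT (pcar d)     = Star.gmap car car-c (par⇒stepsS d)
  par⇒stepsT (pcar-red d) = car-red ◅ par⇒stepsT d
  par⇒stepsT (pμ d)       = Star.gmap μ μ-c (par⇒stepsT d)
  par⇒stepsT {M = M ⋆ π} (p⋆ {M' = M'} d e) =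
    Star.gmap (_⋆ π) ⋆-l (par⇒stepsT d) ◅◅ Star.gmap (M' ⋆_) ⋆-r (par⇒stepsS e)
  par⇒stepsT {M = μ M ⋆ π} (pβ {M' = M'} d e) =
    Star.gmap (λ X → μ X ⋆ π) (λ s → ⋆-l (μ-c s)) (par⇒stepsT d)
    ◅◅ Star.gmap (μ M' ⋆_) ⋆-r (par⇒stepsS e) ◅◅ μ-red ◅ ε

  par⇒stepsS : ∀ {b π π'} → ParS b π π' → StepsS b π π'
  par⇒stepsS pnil         = ε
  par⇒stepsS (pvar x)     = ε
  par⇒stepsS (pcdr d)     = Star.gmap cdr cdr-c (par⇒stepsS d)
  par⇒stepsS (pcdr-red d) = cdr-red ◅ par⇒stepsS d
  par⇒stepsS {π = M :: π} (pcons {M' = M'} d e) =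
    Star.gmap (_:: π) ::-l (par⇒stepsT d) ◅◅ Star.gmap (M' ::_) ::-r (par⇒stepsS e)

mutual
  devT : Term → Term
  devT (car (M :: π)) = devT M
  devT (car ρ)        = car (devS ρ)
  devT (μ M)          = μ (devT M)
  devT (μ M ⋆ π)      = devT M [ devS π ]
  devT (M ⋆ π)        = devT M ⋆ devS π

  devS : Stack → Stack
  devS nil            = nil
  devS (var x)        = var x
  devS (cdr (M :: π)) = devS π
  devS (cdr ρ)        = cdr (devS ρ)
  devS (M :: π)       = devT M :: devS π

mutual
  triangleT : ∀ {M N} → ParT true M N → ParT true N (devT M)
  triangleT (pcar pnil)               = pcar pnil
  triangleT (pcar (pvar x))           = pcar (pvar x)
  triangleT (pcar d@(pcdr _))         = pcar (triangleS d)
  triangleT (pcar d@(pcdr-red _))     = pcar (triangleS d)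
  triangleT (pcar (pcons d e))        = pcar-red (triangleT d)
  triangleT (pcar-red d)              = triangleT d
  triangleT (pμ d)                    = pμ (triangleT d)
  triangleT (p⋆ d@(pcar _) e)         = p⋆ (triangleT d) (triangleS e)
  triangleT (p⋆ d@(pcar-red _) e)     = p⋆ (triangleT d) (triangleS e)
  triangleT (p⋆ (pμ d) e)             = pβ (triangleT d) (triangleS e)
  triangleT (p⋆ d@(p⋆ _ _) e)         = p⋆ (triangleT d) (triangleS e)
  triangleT (p⋆ d@(pβ _ _) e)         = p⋆ (triangleT d) (triangleS e)
  triangleT (pβ d e)                  = par-β (triangleT d) (triangleS e)

  triangleS : ∀ {π π'} → ParS true π π' → ParS true π' (devS π)
  triangleS pnil                      = pnil
  triangleS (pvar x)                  = pvar x
  triangleS (pcdr pnil)               = pcdr pnil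
  triangleS (pcdr (pvar x))           = pcdr (pvar x)
  triangleS (pcdr d@(pcdr _))         = pcdr (triangleS d)
  triangleS (pcdr d@(pcdr-red _))     = pcdr (triangleS d)
  triangleS (pcdr (pcons d e))        = pcdr-red (triangleS e)
  triangleS (pcdr-red d)              = triangleS d
  triangleS (pcons d e)               = pcons (triangleT d) (triangleS e)

Par* : Term → Term → Set
Par* = Star (ParT true)

strip : ∀ {M N N'} → ParT true M N → Par* M N' → ∃ λ Z → Par* N Z × ParT true N' Z
strip {N = N} d ε = N , ε , d
strip d (d' ◅ ds) with strip (triangleT d') ds
... | Z , N→Z , N'⇒Z = Z , triangleT d ◅ N→Z , N'⇒Z

par*-confluent : ∀ {M N N'} → Par* M N → Par* M N' → ∃ λ Z → Par* N Z × Par* N' Z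
par*-confluent ε ds' = _ , ds' , ε
par*-confluent (d ◅ ds) ds' with strip d ds'
... | Z , N₁→Z , N'⇒Z with par*-confluent ds N₁→Z
... | W , N→W , Z→W = W , N→W , N'⇒Z ◅ Z→W

steps⇒par* : ∀ {M N} → Steps true M N → Par* M N
steps⇒par* = Star.map step⇒parT

par*⇒steps : ∀ {M N} → Par* M N → Steps true M N
par*⇒steps ε        = ε
par*⇒steps (d ◅ ds) = par⇒stepsT d ◅◅ par*⇒steps ds

church-rosser : ∀ {X Y} → X =s Y → ∃ λ Z → Steps true X Z × Steps true Y Z
church-rosser ε = _ , ε , ε
church-rosser (fwd s ◅ r) with church-rosser r
... | Z , Y₁→Z , Y→Z = Z , s ◅ Y₁→Z , Y→Z
church-rosser (bwd s ◅ r) with church-rosser r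
... | Z , Y₁→Z , Y→Z with par*-confluent (step⇒parT s ◅ ε) (steps⇒par* Y₁→Z)
... | W , X→W , Z→W = W , par*⇒steps X→W , Y→Z ◅◅ par*⇒steps Z→W

Irreducible : Term → Set
Irreducible Z = ∀ W → ¬ StepT true Z W

reduces-to-irreducible : ∀ {X Z} → X =s Z → Irreducible Z → Steps true X Z
reduces-to-irreducible X=Z irr with church-rosser X=Z
... | W , X→W , ε       = X→W
... | W , X→W , (s ◅ _) with irr _ s
... | ()

carᶜ : Stack → Term
carᶜ (M :: π) = M
carᶜ nil      = car nil
carᶜ (var x)  = car (var x)
carᶜ (cdr ρ)  = car (cdr ρ)

cdrᶜ : Stack → Stack
cdrᶜ (M :: π) = π
cdrᶜ nil      = cdr nil
cdrᶜ (var x)  = cdr (var x)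
cdrᶜ (cdr ρ)  = cdr (cdr ρ)

mutual
  nfT : Term → Term
  nfT (car ρ) = carᶜ (nfS ρ)
  nfT (μ M)   = μ (nfT M)
  nfT (M ⋆ π) = nfT M ⋆ nfS π

  nfS : Stack → Stack
  nfS nil      = nil
  nfS (var x)  = var x
  nfS (cdr ρ)  = cdrᶜ (nfS ρ)
  nfS (M :: π) = nfT M :: nfS π

carᶜ-steps : ∀ ρ → Steps false (car ρ) (carᶜ ρ)
carᶜ-steps (M :: π) = car-red ◅ ε
carᶜ-steps nil      = ε
carᶜ-steps (var x)  = ε
carᶜ-steps (cdr ρ)  = ε

cdrᶜ-steps : ∀ ρ → StepsS false (cdr ρ) (cdrᶜ ρ)
cdrᶜ-steps (M :: π) = cdr-red ◅ ε
cdrᶜ-steps nil      = ε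
cdrᶜ-steps (var x)  = ε
cdrᶜ-steps (cdr ρ)  = ε

mutual
  nf-stepsT : ∀ M → Steps false M (nfT M)
  nf-stepsT (car ρ) = Star.gmap car car-c (nf-stepsS ρ) ◅◅ carᶜ-steps (nfS ρ)
  nf-stepsT (μ M)   = Star.gmap μ μ-c (nf-stepsT M)
  nf-stepsT (M ⋆ π) = Star.gmap (_⋆ π) ⋆-l (nf-stepsT M) ◅◅ Star.gmap (nfT M ⋆_) ⋆-r (nf-stepsS π)

  nf-stepsS : ∀ π → StepsS false π (nfS π)
  nf-stepsS nil      = ε
  nf-stepsS (var x)  = ε
  nf-stepsS (cdr ρ)  = Star.gmap cdr cdr-c (nf-stepsS ρ) ◅◅ cdrᶜ-steps (nfS ρ)
  nf-stepsS (M :: π) = Star.gmap (_:: π) ::-l (nf-stepsT M) ◅◅ Star.gmap (nfT M ::_) ::-r (nf-stepsS π)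

data CdrChain : Stack → Set where
  chain-nil : CdrChain nil
  chain-var : ∀ x → CdrChain (var x)
  chain-cdr : ∀ {ρ} → CdrChain ρ → CdrChain (cdr ρ)

mutual
  data CanonicalS : Stack → Set where
    can-chain : ∀ {ρ} → CdrChain ρ → CanonicalS ρ
    can-cons  : ∀ {M π} → CanonicalT M → CanonicalS π → CanonicalS (M :: π)

  data CanonicalT : Term → Set where
    can-car : ∀ {ρ} → CdrChain ρ → CanonicalT (car ρ)
    can-μ   : ∀ {M} → CanonicalT M → CanonicalT (μ M)
    can-⋆   : ∀ {M π} → CanonicalT M → CanonicalS π → CanonicalT (M ⋆ π)

carᶜ-canonical : ∀ {ρ} → CanonicalS ρ → CanonicalT (carᶜ ρ)
carᶜ-canonical (can-chain chain-nil)       = can-car chain-nil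
carᶜ-canonical (can-chain (chain-var x))   = can-car (chain-var x)
carᶜ-canonical (can-chain (chain-cdr c))   = can-car (chain-cdr c)
carᶜ-canonical (can-cons t s)              = t

cdrᶜ-canonical : ∀ {ρ} → CanonicalS ρ → CanonicalS (cdrᶜ ρ)
cdrᶜ-canonical (can-chain chain-nil)       = can-chain (chain-cdr chain-nil)
cdrᶜ-canonical (can-chain (chain-var x))   = can-chain (chain-cdr (chain-var x))
cdrᶜ-canonical (can-chain (chain-cdr c))   = can-chain (chain-cdr (chain-cdr c))
cdrᶜ-canonical (can-cons t s)              = s

mutual
  nf-canonicalT : ∀ M → CanonicalT (nfT M)
  nf-canonicalT (car ρ) = carᶜ-canonical (nf-canonicalS ρ)
  nf-canonicalT (μ M)   = can-μ (nf-canonicalT M)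
  nf-canonicalT (M ⋆ π) = can-⋆ (nf-canonicalT M) (nf-canonicalS π)

  nf-canonicalS : ∀ π → CanonicalS (nfS π)
  nf-canonicalS nil      = can-chain chain-nil
  nf-canonicalS (var x)  = can-chain (chain-var x)
  nf-canonicalS (cdr ρ)  = cdrᶜ-canonical (nf-canonicalS ρ)
  nf-canonicalS (M :: π) = can-cons (nf-canonicalT M) (nf-canonicalS π)

chain-no-step : ∀ {b ρ ρ'} → CdrChain ρ → ¬ StepS b ρ ρ'
chain-no-step (chain-cdr c) (cdr-c s) = chain-no-step c s

mutual
  canonical-no-stepT : ∀ {W W'} → CanonicalT W → ¬ StepT false W W'
  canonical-no-stepT (can-car c) (car-c s) = chain-no-step c s
  canonical-no-stepT (can-μ t) (μ-c s)     = canonical-no-stepT t s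
  canonical-no-stepT (can-⋆ t n) (⋆-l s)   = canonical-no-stepT t s
  canonical-no-stepT (can-⋆ t n) (⋆-r s)   = canonical-no-stepS n s

  canonical-no-stepS : ∀ {π π'} → CanonicalS π → ¬ StepS false π π'
  canonical-no-stepS (can-chain c) s        = chain-no-step c s
  canonical-no-stepS (can-cons t n) (::-l s) = canonical-no-stepT t s
  canonical-no-stepS (can-cons t n) (::-r s) = canonical-no-stepS n s

mutual
  nf-stepT : ∀ {M M'} → StepT false M M' → nfT M ≡ nfT M'
  nf-stepT car-red   = refl
  nf-stepT (car-c s) = cong carᶜ (nf-stepS s)
  nf-stepT (μ-c s)   = cong μ (nf-stepT s)
  nf-stepT (⋆-l s)   = cong (_⋆ _) (nf-stepT s)
  nf-stepT (⋆-r s)   = cong (_ ⋆_) (nf-stepS s)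

  nf-stepS : ∀ {π π'} → StepS false π π' → nfS π ≡ nfS π'
  nf-stepS cdr-red    = refl
  nf-stepS (cdr-c s)  = cong cdrᶜ (nf-stepS s)
  nf-stepS (::-l s)   = cong (_:: _) (nf-stepT s)
  nf-stepS (::-r s)   = cong (_ ::_) (nf-stepS s)

nf-steps : ∀ {M M'} → Steps false M M' → nfT M ≡ nfT M'
nf-steps ε        = refl
nf-steps (s ◅ ss) = trans (nf-stepT s) (nf-steps ss)

normal-reduct : ∀ {W V} → CCNormal W → Steps false W V → V ≡ W
normal-reduct normal ε       = refl
normal-reduct normal (s ◅ _) = ⊥-elim (normal _ s)

nf-is-canonical : ∀ M → CanonicalForm M (nfT M)
nf-is-canonical M = nf-stepsT M , λ _ → canonical-no-stepT (nf-canonicalT M)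

canonical-form-unique : ∀ {M W} → CanonicalForm M W → W ≡ nfT M
canonical-form-unique {M} {W} (M→W , normal) =
  trans (sym (normal-reduct normal (nf-stepsT W))) (sym (nf-steps M→W))

-- Head reduction only looks at the canonical form, so terms with the same
-- canonical form have the same head reducts and the same solvability.
canonical-form-transfer : ∀ {X X₁ W} → nfT X ≡ nfT X₁ → CanonicalForm X₁ W → CanonicalForm X W
canonical-form-transfer {X} X≡X₁ cf =
  subst (CanonicalForm X) (trans X≡X₁ (sym (canonical-form-unique cf))) (nf-is-canonical X)

head-step-transfer : ∀ {X X₁ Y} → nfT X ≡ nfT X₁ → X₁ →h Y → X →h Y
head-step-transfer X≡X₁ (head k N ϖ πs cf) = head k N ϖ πs (canonical-form-transfer X≡X₁ cf)

solvable-transfer : ∀ {X X₁} → nfT X ≡ nfT X₁ → HeadReducesToProper X₁ → HeadReducesToProper X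
solvable-transfer {X} X≡X₁ (H , ε , irreducible , k , n , β , πs , cf) =
  X , ε , (λ Y r → irreducible Y (head-step-transfer (sym X≡X₁) r)) ,
  k , n , β , πs , canonical-form-transfer X≡X₁ cf
solvable-transfer X≡X₁ (H , r ◅ rs , proper) = H , head-step-transfer X≡X₁ r ◅ rs , proper

-- Weak head reduction contracts only the redex in head position, without
-- normalising projections elsewhere.  A spine step contracts cdr(M :: π)
-- at the bottom of a cdr-chain.
data SpineStep : Stack → Stack → Set where
  spine-red : ∀ {M π} → SpineStep (cdr (M :: π)) π
  spine-cdr : ∀ {ρ ρ'} → SpineStep ρ ρ' → SpineStep (cdr ρ) (cdr ρ')

data HeadBeta : Term → Term → Set where
  hβ     : ∀ {N ϖ} → HeadBeta (μ N ⋆ ϖ) (N [ ϖ ])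
  hβ-app : ∀ {M M' π} → HeadBeta M M' → HeadBeta (M ⋆ π) (M' ⋆ π)

data HeadProj : Term → Term → Set where
  hp-spine : ∀ {ρ ρ'} → SpineStep ρ ρ' → HeadProj (car ρ) (car ρ')
  hp-car   : ∀ {M π} → HeadProj (car (M :: π)) M
  hp-app   : ∀ {M M' π} → HeadProj M M' → HeadProj (M ⋆ π) (M' ⋆ π)

data WeakHead (M M' : Term) : Set where
  wh-β    : HeadBeta M M' → WeakHead M M'
  wh-proj : HeadProj M M' → WeakHead M M'

WeakHead* : Term → Term → Set
WeakHead* = Star WeakHead

wh-app* : ∀ {M M'} π → WeakHead* M M' → WeakHead* (M ⋆ π) (M' ⋆ π)
wh-app* π = Star.gmap (_⋆ π) app
  where app : ∀ {M M'} → WeakHead M M' → WeakHead (M ⋆ π) (M' ⋆ π)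
        app (wh-β s)    = wh-β (hβ-app s)
        app (wh-proj s) = wh-proj (hp-app s)

wh-car* : ∀ {ρ ρ'} → Star SpineStep ρ ρ' → WeakHead* (car ρ) (car ρ')
wh-car* = Star.gmap car (λ s → wh-proj (hp-spine s))

spine-cdr* : ∀ {ρ ρ'} → Star SpineStep ρ ρ' → Star SpineStep (cdr ρ) (cdr ρ')
spine-cdr* = Star.gmap cdr spine-cdr

data VarChain : Stack → Set where
  vchain-var : ∀ x → VarChain (var x)
  vchain-cdr : ∀ {ρ} → VarChain ρ → VarChain (cdr ρ)

data Neutral : Term → Set where
  neutral-car : ∀ {ρ} → VarChain ρ → Neutral (car ρ)
  neutral-app : ∀ {M π} → Neutral M → Neutral (M ⋆ π)

data WHNormalising : ℕ → Term → Set where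
  whn-done : ∀ {M} → Neutral M → WHNormalising 0 M
  whn-β    : ∀ {b M M'} → HeadBeta M M' → WHNormalising b M' → WHNormalising (suc b) M
  whn-proj : ∀ {b M M'} → HeadProj M M' → WHNormalising b M' → WHNormalising b M

WHNormalisable : Term → Set
WHNormalisable M = ∃ λ b → WHNormalising b M

whn-prepend : ∀ {M M'} → WeakHead* M M' → WHNormalisable M' → WHNormalisable M
whn-prepend ε h = h
whn-prepend (wh-β s ◅ ss) h with whn-prepend ss h
... | b , h' = suc b , whn-β s h'
whn-prepend (wh-proj s ◅ ss) h with whn-prepend ss h
... | b , h' = b , whn-proj s h'

-- Internal parallel reductions: parallel steps that keep the head of the
-- term (the head redex, head projection or binder) in place.
data InternalS : Stack → Stack → Set where
  int-nil  : InternalS nil nil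
  int-var  : ∀ x → InternalS (var x) (var x)
  int-cons : ∀ {M M' π π'} → ParT true M M' → ParS true π π' → InternalS (M :: π) (M' :: π')
  int-cdr  : ∀ {ρ ρ'} → InternalS ρ ρ' → InternalS (cdr ρ) (cdr ρ')

data InternalApp : Term → Term → Set where
  int-redex : ∀ {Q Q' θ θ'} → ParT true Q Q' → ParS true θ θ' → InternalApp (μ Q ⋆ θ) (μ Q' ⋆ θ')
  int-app   : ∀ {A A' π π'} → InternalApp A A' → ParS true π π' → InternalApp (A ⋆ π) (A' ⋆ π')
  int-car   : ∀ {ρ ρ'} → InternalS ρ ρ' → InternalApp (car ρ) (car ρ')

data Internal : Term → Term → Set where
  int-μ    : ∀ {Q Q'} → ParT true Q Q' → Internal (μ Q) (μ Q')
  int-head : ∀ {M M'} → InternalApp M M' → Internal M M'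

internal-app : ∀ {M M' π π'} → Internal M M' → ParS true π π' → InternalApp (M ⋆ π) (M' ⋆ π')
internal-app (int-μ d)    e = int-redex d e
internal-app (int-head a) e = int-app a e

spine-sub : ∀ σ {ρ ρ'} → SpineStep ρ ρ' → SpineStep (subS σ ρ) (subS σ ρ')
spine-sub σ spine-red     = spine-red
spine-sub σ (spine-cdr s) = spine-cdr (spine-sub σ s)

wh-sub* : ∀ σ {M M'} → WeakHead* M M' → WeakHead* (subT σ M) (subT σ M')
wh-sub* σ = Star.gmap (subT σ) wh-sub
  where
    beta-sub : ∀ {M M'} → HeadBeta M M' → HeadBeta (subT σ M) (subT σ M')
    beta-sub (hβ {N} {ϖ}) = subst (HeadBeta _) (sym (sub-β σ N ϖ)) hβ
    beta-sub (hβ-app s)   = hβ-app (beta-sub s)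

    proj-sub : ∀ {M M'} → HeadProj M M' → HeadProj (subT σ M) (subT σ M')
    proj-sub (hp-spine s) = hp-spine (spine-sub σ s)
    proj-sub hp-car       = hp-car
    proj-sub (hp-app s)   = hp-app (proj-sub s)

    wh-sub : ∀ {M M'} → WeakHead M M' → WeakHead (subT σ M) (subT σ M')
    wh-sub (wh-β s)    = wh-β (beta-sub s)
    wh-sub (wh-proj s) = wh-proj (proj-sub s)

par-split-stack : ∀ {ρ ρ'} → ParS true ρ ρ' → ∃ λ s → Star SpineStep ρ s × InternalS s ρ'
par-split-stack pnil         = _ , ε , int-nil
par-split-stack (pvar x)     = _ , ε , int-var x
par-split-stack (pcdr d) with par-split-stack d
... | s , ρ→s , s⇒ρ' = cdr s , spine-cdr* ρ→s , int-cdr s⇒ρ'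
par-split-stack (pcdr-red e) with par-split-stack e
... | s , π→s , s⇒ρ' = s , spine-red ◅ π→s , s⇒ρ'
par-split-stack (pcons d e)  = _ , ε , int-cons d e

SplitSub : (ℕ → Stack) → (ℕ → Stack) → Set
SplitSub τ τ' = ∀ x → ∃ λ s → Star SpineStep (τ x) s × InternalS s (τ' x)

split-single : ∀ {ϖ ϖ'} → ParS true ϖ ϖ' → SplitSub (single ϖ) (single ϖ')
split-single e zero    = par-split-stack e
split-single e (suc x) = var x , ε , int-var x

-- Substituting into an internal step may expose new head steps (when a
-- variable at the head is replaced), which the split substitution supplies.
internal-subS : ∀ {τ τ' ρ ρ'} → ParSub true τ τ' → SplitSub τ τ' → InternalS ρ ρ' →
                ∃ λ s → Star SpineStep (subS τ ρ) s × InternalS s (subS τ' ρ')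
internal-subS h split int-nil        = _ , ε , int-nil
internal-subS h split (int-var x)    = split x
internal-subS h split (int-cons d e) = _ , ε , int-cons (par-subT h d) (par-subS h e)
internal-subS h split (int-cdr i) with internal-subS h split i
... | s , ρ→s , s⇒ρ' = cdr s , spine-cdr* ρ→s , int-cdr s⇒ρ'

internal-sub : ∀ {τ τ' L P} → ParSub true τ τ' → SplitSub τ τ' → Internal L P →
               ∃ λ L' → WeakHead* (subT τ L) L' × Internal L' (subT τ' P)
internal-sub h split (int-μ d) = _ , ε , int-μ (par-subT (par-exts h) d)
internal-sub h split (int-head (int-redex d e)) =
  _ , ε , int-head (int-redex (par-subT (par-exts h) d) (par-subS h e))
internal-sub h split (int-head (int-app a e)) with internal-sub h split (int-head a)
... | L₁ , r , i = _ , wh-app* _ r , int-head (internal-app i (par-subS h e))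
internal-sub h split (int-head (int-car i)) with internal-subS h split i
... | s , ρ→s , s⇒ρ' = car s , wh-car* ρ→s , int-head (int-car s⇒ρ')

par-split : ∀ {M N} → ParT true M N → ∃ λ L → WeakHead* M L × Internal L N
par-split (pcar d) with par-split-stack d
... | s , ρ→s , s⇒ρ' = car s , wh-car* ρ→s , int-head (int-car s⇒ρ')
par-split (pcar-red d) with par-split d
... | L , M→L , L⇒N = L , wh-proj hp-car ◅ M→L , L⇒N
par-split (pμ d) = _ , ε , int-μ d
par-split (p⋆ d e) with par-split d
... | L , M→L , L⇒N = _ , wh-app* _ M→L , int-head (internal-app L⇒N e)
par-split (pβ {π = π} d e) with par-split d
... | L₀ , M→L₀ , L₀⇒N with internal-sub (par-single e) (split-single e) L₀⇒N
... | L , r , L⇒N = L , wh-β hβ ◅ (wh-sub* (single π) M→L₀ ◅◅ r) , L⇒N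

internal-reflects-neutral : ∀ {L N} → Internal L N → Neutral N → Neutral L
internal-reflects-neutral (int-μ d) ()
internal-reflects-neutral (int-head a) h = app a h
  where
    chain : ∀ {ρ ρ'} → InternalS ρ ρ' → VarChain ρ' → VarChain ρ
    chain (int-var x) (vchain-var .x) = vchain-var x
    chain (int-cdr i) (vchain-cdr v)  = vchain-cdr (chain i v)

    app : ∀ {L N} → InternalApp L N → Neutral N → Neutral L
    app (int-app a e) (neutral-app h) = neutral-app (app a h)
    app (int-car i) (neutral-car v)   = neutral-car (chain i v)
    app (int-redex d e) (neutral-app ())

internal-then-spine : ∀ {ρ ρ' ρ''} → InternalS ρ ρ' → SpineStep ρ' ρ'' →
                      ∃ λ s → Star SpineStep ρ s × ParS true s ρ''
internal-then-spine (int-cdr (int-cons d e)) spine-red = _ , spine-red ◅ ε , e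
internal-then-spine (int-cdr i) (spine-cdr s) with internal-then-spine i s
... | t , ρ→t , t⇒ρ'' = cdr t , spine-cdr* ρ→t , pcdr t⇒ρ''

internal-then-beta : ∀ {L M M'} → InternalApp L M → HeadBeta M M' →
                     ∃ λ L' → WeakHead* L L' × ParT true L' M'
internal-then-beta (int-redex d e) hβ = _ , wh-β hβ ◅ ε , par-β d e
internal-then-beta (int-app a e) (hβ-app s) with internal-then-beta a s
... | L' , r , p = _ , wh-app* _ r , p⋆ p e
internal-then-beta (int-app () e) hβ
internal-then-beta (int-redex d e) (hβ-app ())

internal-then-proj : ∀ {L M M'} → InternalApp L M → HeadProj M M' →
                     ∃ λ L' → WeakHead* L L' × ParT true L' M'
internal-then-proj (int-car i) (hp-spine s) with internal-then-spine i s
... | t , ρ→t , t⇒ρ' = car t , wh-car* ρ→t , pcar t⇒ρ'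
internal-then-proj (int-car (int-cons d e)) hp-car = _ , wh-proj hp-car ◅ ε , d
internal-then-proj (int-app a e) (hp-app s) with internal-then-proj a s
... | L' , r , p = _ , wh-app* _ r , p⋆ p e
internal-then-proj (int-redex d e) (hp-app ())

mutual
  whn-par : ∀ {b M M₁} → ParT true M M₁ → WHNormalising b M₁ → WHNormalisable M
  whn-par d h with par-split d
  ... | L , M→L , L⇒M₁ = whn-prepend M→L (whn-internal L⇒M₁ h)

  whn-internal : ∀ {b L M₁} → Internal L M₁ → WHNormalising b M₁ → WHNormalisable L
  whn-internal i (whn-done h) = 0 , whn-done (internal-reflects-neutral i h)
  whn-internal (int-μ d) (whn-β () h)
  whn-internal (int-μ d) (whn-proj () h)
  whn-internal (int-head a) (whn-β s h) with internal-then-beta a s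
  ... | L' , r , p = whn-prepend r (whn-par p h)
  whn-internal (int-head a) (whn-proj s h) with internal-then-proj a s
  ... | L' , r , p = whn-prepend r (whn-par p h)

standardise : ∀ {M Z} → Steps true M Z → Neutral Z → WHNormalisable M
standardise ε h = 0 , whn-done h
standardise (s ◅ ss) h with standardise ss h
... | b , h' = whn-par (step⇒parT s) h'

spine-vs-proj : ∀ {ρ ρ' ρ''} → SpineStep ρ ρ' → ParS false ρ ρ'' →
                ParS false ρ' ρ'' ⊎ ∃ λ ρ₃ → SpineStep ρ'' ρ₃ × ParS false ρ' ρ₃
spine-vs-proj spine-red (pcdr (pcons d e)) = inj₂ (_ , spine-red , e)
spine-vs-proj spine-red (pcdr-red e)       = inj₁ e
spine-vs-proj (spine-cdr s) (pcdr d) with spine-vs-proj s d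
... | inj₁ p            = inj₁ (pcdr p)
... | inj₂ (_ , s' , p) = inj₂ (_ , spine-cdr s' , pcdr p)
spine-vs-proj (spine-cdr ()) (pcdr-red e)

beta-vs-proj : ∀ {X X₁ X₂} → HeadBeta X X₁ → ParT false X X₂ →
               ∃ λ Y → HeadBeta X₂ Y × ParT false X₁ Y
beta-vs-proj hβ (p⋆ (pμ d) e) = _ , hβ , par-β d e
beta-vs-proj (hβ-app s) (p⋆ d e) with beta-vs-proj s d
... | _ , s' , p = _ , hβ-app s' , p⋆ p e

headproj-vs-proj : ∀ {X X₁ X₂} → HeadProj X X₁ → ParT false X X₂ →
                   ParT false X₁ X₂ ⊎ ∃ λ Y → HeadProj X₂ Y × ParT false X₁ Y
headproj-vs-proj (hp-spine s) (pcar d) with spine-vs-proj s d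
... | inj₁ p            = inj₁ (pcar p)
... | inj₂ (_ , s' , p) = inj₂ (_ , hp-spine s' , pcar p)
headproj-vs-proj hp-car (pcar (pcons d e)) = inj₂ (_ , hp-car , d)
headproj-vs-proj hp-car (pcar-red d)       = inj₁ d
headproj-vs-proj (hp-app s) (p⋆ d e) with headproj-vs-proj s d
... | inj₁ p            = inj₁ (p⋆ p e)
... | inj₂ (_ , s' , p) = inj₂ (_ , hp-app s' , p⋆ p e)

-- Neutrality is preserved by parallel reduction (the head variable blocks
-- every redex at the head).
varchain-par : ∀ {b ρ ρ'} → VarChain ρ → ParS b ρ ρ' → VarChain ρ'
varchain-par (vchain-var x) (pvar .x)   = vchain-var x
varchain-par (vchain-cdr v) (pcdr d)    = vchain-cdr (varchain-par v d)
varchain-par (vchain-cdr ()) (pcdr-red d)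

neutral-par : ∀ {b X X'} → Neutral X → ParT b X X' → Neutral X'
neutral-par (neutral-car v) (pcar d)    = neutral-car (varchain-par v d)
neutral-par (neutral-car ()) (pcar-red d)
neutral-par (neutral-app h) (p⋆ d e)    = neutral-app (neutral-par h d)
neutral-par (neutral-app ()) (pβ d e)

neutral-steps : ∀ {b X W} → Neutral X → Steps b X W → Neutral W
neutral-steps h ε        = h
neutral-steps h (s ◅ ss) = neutral-steps (neutral-par h (step⇒parT s)) ss

Proj* : Term → Term → Set
Proj* = Star (ParT false)

whn-proj* : ∀ {b X X'} → WHNormalising b X → Proj* X X' → WHNormalising b X'
whn-proj* h ε        = h
whn-proj* h (d ◅ ds) = whn-proj* (whn-proj-par h d) ds
  where
    whn-proj-par : ∀ {b X X'} → WHNormalising b X → ParT false X X' → WHNormalising b X'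
    whn-proj-par (whn-done h) d = whn-done (neutral-par h d)
    whn-proj-par (whn-β s h) d with beta-vs-proj s d
    ... | _ , s' , p = whn-β s' (whn-proj-par h p)
    whn-proj-par (whn-proj s h) d with headproj-vs-proj s d
    ... | inj₁ p            = whn-proj-par h p
    ... | inj₂ (_ , s' , p) = whn-proj s' (whn-proj-par h p)

apps-snoc : ∀ M πs π → apps M (πs ++ π ∷ []) ≡ apps M πs ⋆ π
apps-snoc M []        π = refl
apps-snoc M (π' ∷ πs) π = apps-snoc (M ⋆ π') πs π

beta-shape : ∀ {X X₁} → HeadBeta X X₁ → ∃ λ N → ∃ λ ϖ → ∃ λ πs →
             X ≡ apps (μ N ⋆ ϖ) πs × X₁ ≡ apps (N [ ϖ ]) πs
beta-shape hβ = _ , _ , [] , refl , refl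
beta-shape (hβ-app {π = π} s) with beta-shape s
... | N , ϖ , πs , refl , refl = N , ϖ , πs ++ π ∷ [] , sym (apps-snoc _ πs π) , sym (apps-snoc _ πs π)

varchain-shape : ∀ {ρ} → VarChain ρ → ∃ λ n → ∃ λ β → ρ ≡ cdr^ n (var β)
varchain-shape (vchain-var x) = 0 , x , refl
varchain-shape (vchain-cdr v) with varchain-shape v
... | n , β , refl = suc n , β , refl

neutral-shape : ∀ {X} → Neutral X → ∃ λ n → ∃ λ β → ∃ λ πs → X ≡ apps (carₙ n (var β)) πs
neutral-shape (neutral-car v) with varchain-shape v
... | n , β , refl = n , β , [] , refl
neutral-shape (neutral-app {π = π} h) with neutral-shape h
... | n , β , πs , refl = n , β , πs ++ π ∷ [] , sym (apps-snoc _ πs π)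

neutral-apps : ∀ {M} πs → Neutral M → Neutral (apps M πs)
neutral-apps []       h = h
neutral-apps (π ∷ πs) h = neutral-apps πs (neutral-app h)

neutral-apps⁻¹ : ∀ M πs → Neutral (apps M πs) → Neutral M
neutral-apps⁻¹ M []       h = h
neutral-apps⁻¹ M (π ∷ πs) h with neutral-apps⁻¹ (M ⋆ π) πs h
... | neutral-app h' = h'

varchain-cdr^ : ∀ n β → VarChain (cdr^ n (var β))
varchain-cdr^ zero    β = vchain-var β
varchain-cdr^ (suc n) β = vchain-cdr (varchain-cdr^ n β)

redex-not-neutral : ∀ k N ϖ πs → ¬ Neutral (mus k (apps (μ N) (ϖ ∷ πs)))
redex-not-neutral zero N ϖ πs h with neutral-apps⁻¹ (μ N ⋆ ϖ) πs h
... | neutral-app ()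
redex-not-neutral (suc k) N ϖ πs ()

neutral-proper : ∀ {X} → Neutral X → ProperHnf X
neutral-proper {X} h with neutral-shape (neutral-steps h (nf-stepsT X))
... | n , β , πs , nf≡ = irreducible , 0 , n , β , πs , subst (CanonicalForm X) nf≡ (nf-is-canonical X)
  where
    irreducible : HeadIrreducible X
    irreducible Y (head k N ϖ πs (X→redex , _)) = redex-not-neutral k N ϖ πs (neutral-steps h X→redex)

-- A weak head β-step is a head step of the calculus, up to projection
-- steps on the result (head reduction first passes to canonical forms).
nf-apps : ∀ M πs → nfT (apps M πs) ≡ apps (nfT M) (map nfS πs)
nf-apps M []       = refl
nf-apps M (π ∷ πs) = nf-apps (M ⋆ π) πs

par-apps : ∀ {b M M'} πs → ParT b M M' → ParT b (apps M πs) (apps M' πs)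
par-apps []       d = d
par-apps (π ∷ πs) d = par-apps πs (p⋆ d (par-reflS π))

nf-proj*S : ∀ π → Star (ParS false) π (nfS π)
nf-proj*S π = Star.map step⇒parS (nf-stepsS π)

args-nf : ∀ M πs → Proj* (apps M πs) (apps M (map nfS πs))
args-nf M []       = ε
args-nf M (π ∷ πs) =
  Star.gmap (λ ρ → apps (M ⋆ ρ) πs) (λ e → par-apps πs (p⋆ (par-reflT M) e)) (nf-proj*S π)
  ◅◅ args-nf (M ⋆ nfS π) πs

contractum-nf : ∀ N ϖ → Proj* (N [ ϖ ]) (nfT N [ nfS ϖ ])
contractum-nf N ϖ =
  Star.gmap (_[ ϖ ]) (λ d → par-β d (par-reflS ϖ)) (Star.map step⇒parT (nf-stepsT N))
  ◅◅ Star.gmap (nfT N [_]) (par-β (par-reflT _)) (nf-proj*S ϖ)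

head-beta-step : ∀ {X X₁} → HeadBeta X X₁ → ∃ λ Y → (X →h Y) × Proj* X₁ Y
head-beta-step s with beta-shape s
... | N , ϖ , πs , refl , refl =
  apps (nfT N [ nfS ϖ ]) (map nfS πs) ,
  head 0 (nfT N) (nfS ϖ) (map nfS πs)
       (subst (CanonicalForm _) (nf-apps (μ N ⋆ ϖ) πs) (nf-is-canonical _)) ,
  Star.gmap (λ Z → apps Z πs) (par-apps πs) (contractum-nf N ϖ) ◅◅ args-nf _ πs

headproj-step : ∀ {M M'} → HeadProj M M' → StepT false M M'
headproj-step (hp-spine s) = car-c (spine s)
  where spine : ∀ {ρ ρ'} → SpineStep ρ ρ' → StepS false ρ ρ'
        spine spine-red     = cdr-red
        spine (spine-cdr s) = cdr-c (spine s)
headproj-step hp-car       = car-red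
headproj-step (hp-app s)   = ⋆-l (headproj-step s)

whn-solvable : ∀ b {X} → WHNormalising b X → HeadReducesToProper X
whn-solvable .0 (whn-done h)     = _ , ε , neutral-proper h
whn-solvable b (whn-proj s h)    = solvable-transfer (nf-stepT (headproj-step s)) (whn-solvable b h)
whn-solvable (suc b) (whn-β s h) with head-beta-step s
... | Y , X→Y , X₁⇒Y with whn-solvable b (whn-proj* h X₁⇒Y)
... | H , Y→H , proper = H , X→Y ◅ Y→H , proper

convertible-to-neutral-solvable : ∀ {X Z} → X =s Z → Irreducible Z → Neutral Z → HeadReducesToProper X
convertible-to-neutral-solvable X=Z irreducible h with standardise (reduces-to-irreducible X=Z irreducible) h
... | b , whn = whn-solvable b whn

data NeutralUnderμ : Term → Set where
  nμ-neutral : ∀ {M} → Neutral M → NeutralUnderμ M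
  nμ-μ       : ∀ {M} → NeutralUnderμ M → NeutralUnderμ (μ M)

neutral-under-μ-steps : ∀ {M M'} → NeutralUnderμ M → Steps true M M' → NeutralUnderμ M'
neutral-under-μ-steps v ε = v
neutral-under-μ-steps v (s ◅ ss) = neutral-under-μ-steps (step v s) ss
  where
    step : ∀ {M M'} → NeutralUnderμ M → StepT true M M' → NeutralUnderμ M'
    step (nμ-neutral h) s = nμ-neutral (neutral-par h (step⇒parT s))
    step (nμ-μ v) (μ-c s) = nμ-μ (step v s)

proper-shape : ∀ k n β πs → NeutralUnderμ (mus k (apps (carₙ n (var β)) πs))
proper-shape zero    n β πs = nμ-neutral (neutral-apps πs (neutral-car (varchain-cdr^ n β)))
proper-shape (suc k) n β πs = nμ-μ (proper-shape k n β πs)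

mutual
  proj⇒stepT : ∀ {M M'} → StepT false M M' → StepT true M M'
  proj⇒stepT car-red   = car-red
  proj⇒stepT (car-c s) = car-c (proj⇒stepS s)
  proj⇒stepT (μ-c s)   = μ-c (proj⇒stepT s)
  proj⇒stepT (⋆-l s)   = ⋆-l (proj⇒stepT s)
  proj⇒stepT (⋆-r s)   = ⋆-r (proj⇒stepS s)

  proj⇒stepS : ∀ {π π'} → StepS false π π' → StepS true π π'
  proj⇒stepS cdr-red   = cdr-red
  proj⇒stepS (cdr-c s) = cdr-c (proj⇒stepS s)
  proj⇒stepS (::-l s)  = ::-l (proj⇒stepT s)
  proj⇒stepS (::-r s)  = ::-r (proj⇒stepS s)

musβ : ∀ {M M'} k πs → StepT true M M' → StepT true (mus k (apps M πs)) (mus k (apps M' πs))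
musβ zero    []       s = s
musβ zero    (π ∷ πs) s = musβ zero πs (⋆-l s)
musβ (suc k) πs       s = μ-c (musβ k πs s)

head*⇒steps : ∀ {X Y} → Star _→h_ X Y → Steps true X Y
head*⇒steps ε = ε
head*⇒steps (head k N ϖ πs (X→redex , _) ◅ rs) =
  Star.map proj⇒stepT X→redex ◅◅ musβ k πs μ-red ◅ head*⇒steps rs

steps⇒=s : ∀ {X Y} → Steps true X Y → X =s Y
steps⇒=s = Star.map fwd

-- (b) A term convertible with an irreducible term that is not neutral
-- under μ's is not solvable: its proper hnf would reduce to that term.
convertible-to-non-neutral-unsolvable : ∀ {Y Z} → Y =s Z → Irreducible Z → ¬ NeutralUnderμ Z →
                                        ¬ HeadReducesToProper Y
convertible-to-non-neutral-unsolvable {Z = Z} Y=Z irreducible not-neutral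
  (H , Y→H , _ , k , n , β , πs , (H→W , _)) =
  not-neutral (neutral-under-μ-steps (proper-shape k n β πs) (reduces-to-irreducible W=Z irreducible))
  where
    W=Z : mus k (apps (carₙ n (var β)) πs) =s Z
    W=Z = EQ.symmetric (StepT true) (steps⇒=s (head*⇒steps Y→H ◅◅ Star.map proj⇒stepT H→W)) ◅◅ Y=Z

π₀ : Stack
π₀ = car (var 0) :: car nil :: nil

T-on-π₀ : Steps true (𝐓 ⋆ π₀) (car (var 0) ⋆ nil)
T-on-π₀ = μ-red ◅ ⋆-l car-red ◅ ⋆-r (cdr-c cdr-red) ◅ ⋆-r cdr-red ◅ ε

F-on-π₀ : Steps true (𝐅 ⋆ π₀) (car nil ⋆ nil)
F-on-π₀ = μ-red ◅ ⋆-l (car-c cdr-red) ◅ ⋆-l car-red ◅ ⋆-r (cdr-c cdr-red) ◅ ⋆-r cdr-red ◅ ε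

car-chain-irreducible : ∀ {ρ} → CdrChain ρ → Irreducible (car ρ ⋆ nil)
car-chain-irreducible c _ (⋆-l (car-c s)) = chain-no-step c s
car-chain-irreducible c _ (⋆-r ())

car-nil-not-neutral : ¬ NeutralUnderμ (car nil ⋆ nil)
car-nil-not-neutral (nμ-neutral (neutral-app (neutral-car ())))

on-π₀ : ∀ {X V W} → X =s V → Steps true (V ⋆ π₀) W → X ⋆ π₀ =s W
on-π₀ X=V V→W = EQ.gmap (_⋆ π₀) ⋆-l X=V ◅◅ steps⇒=s V→W

theorem6 : ∀ (M N : Term) → Separable M N → ¬ (M ≃ N)
theorem6 M N (C , CM=T , CN=F) M≃N = CN⋆π₀-unsolvable (only-if CM⋆π₀-solvable)
  where
    only-if : HeadReducesToProper (C ⟦ M ⟧ ⋆ π₀) → HeadReducesToProper (C ⟦ N ⟧ ⋆ π₀)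
    only-if = proj₁ (M≃N (C ⋆C π₀))
    CM⋆π₀-solvable : HeadReducesToProper (C ⟦ M ⟧ ⋆ π₀)
    CM⋆π₀-solvable = convertible-to-neutral-solvable (on-π₀ CM=T T-on-π₀)
      (car-chain-irreducible (chain-var 0)) (neutral-app (neutral-car (vchain-var 0)))
    CN⋆π₀-unsolvable : ¬ HeadReducesToProper (C ⟦ N ⟧ ⋆ π₀)
    CN⋆π₀-unsolvable = convertible-to-non-neutral-unsolvable (on-π₀ CN=F F-on-π₀)
      (car-chain-irreducible chain-nil) car-nil-not-neutral
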